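{- If a class $\mathcal{G}$ of graphs is fractionally $\mathrm{Vs}$-fragile, then it has bounded maximum degree.
   Context: $\mathrm{Vs}$ is the class property consisting of all graph classes $\mathcal{C}$ for which there is $t\ge0$ such that every connected component of every graph in $\mathcal{C}$ has at most $t$ vertices. For a graph $G$ and class $\mathcal{C}$, let $G-\mathcal{C}=\{X\subseteq V(G):G-X\in\mathcal{C}\}$; a fractional $\mathcal{C}$-complementary packing in $G$ is a map $\pi:G-\mathcal{C}\to[0,1]$ with $\sum_X\pi(X)=1$, and its thickness is $\max_{v\in V(G)}\sum_{X\ni v}\pi(X)$. $\mathcal{G}$ is fractionally $\mathrm{Vs}$-fragile if for every $\varepsilon>0$ there exists $\mathcal{C}\in\mathrm{Vs}$ such that every graph in $\mathcal{G}$ has a fractional $\mathcal{C}$-complementary packing of thickness at most $\varepsilon$.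
   Formalization: The fractional $\mathcal{C}$-complementary packings π take rational values in [0,1], and ε ranges over the positive rationals rather than the positive reals. -}

module Defs where

open import Data.Bool using (Bool; true; false; not; T)
open import Data.Nat using (ℕ; zero; suc) renaming (_≤_ to _≤ℕ_)
open import Data.Fin using (Fin)
open import Data.Fin.Subset using (Subset; _∈_; ∣_∣)
open import Data.Vec as Vec using (Vec; []; _∷_)
open import Data.List as List using (List; []; _∷_; _++_; length; filterᵇ; allFin; foldr)
open import Data.Rational using (ℚ; 0ℚ; 1ℚ; _+_; _⊔_; _≤_; _<_)
open import Data.Product using (Σ; _×_; ∃)
open import Relation.Binary.PropositionalEquality using (_≡_; _≢_)

record Graph : Set where
  field
    n      : ℕ
    adj    : Fin n → Fin n → Bool
    sym    : ∀ u v → adj u v ≡ adj v u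
    irrefl : ∀ v → adj v v ≡ false
open Graph public

GraphClass : Set₁
GraphClass = Graph → Set

-- Induced subgraph G - X : vertices of G outside X, listed in increasing
-- order and re-indexed by Fin of the appropriate size.

remaining : (G : Graph) → Subset (n G) → List (Fin (n G))
remaining G X = filterᵇ (λ v → not (Vec.lookup X v)) (allFin (n G))

_─_ : (G : Graph) → Subset (n G) → Graph
G ─ X = record
  { n      = length (remaining G X)
  ; adj    = λ i j → adj G (List.lookup (remaining G X) i) (List.lookup (remaining G X) j)
  ; sym    = λ i j → sym G (List.lookup (remaining G X) i) (List.lookup (remaining G X) j)
  ; irrefl = λ i → irrefl G (List.lookup (remaining G X) i)
  }

data Reach (G : Graph) : Fin (n G) → Fin (n G) → Set where
  here : ∀ {v} → Reach G v v
  step : ∀ {u w v} → T (adj G u w) → Reach G w v → Reach G u v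

-- Every connected component of G has at most t vertices: for every vertex v,
-- every set S of vertices contained in the component of v has |S| ≤ t.
ComponentsAtMost : ℕ → Graph → Set
ComponentsAtMost t G =
  ∀ (v : Fin (n G)) (S : Subset (n G)) → (∀ u → u ∈ S → Reach G v u) → ∣ S ∣ ≤ℕ t

InVs : GraphClass → Set
InVs C = Σ ℕ λ t → ∀ G → C G → ComponentsAtMost t G

allSubsets : (m : ℕ) → List (Subset m)
allSubsets zero    = [] ∷ []
allSubsets (suc m) = List.map (false ∷_) (allSubsets m) ++ List.map (true ∷_) (allSubsets m)

sumℚ : List ℚ → ℚ
sumℚ = foldr _+_ 0ℚ

-- A map π : G - C → [0,1], represented as a function on all subsets of V(G)
-- which vanishes outside G - C = {X : G - X ∈ C}.
record FracPacking (C : GraphClass) (G : Graph) : Set where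
  field
    π        : Subset (n G) → ℚ
    support  : ∀ X → π X ≢ 0ℚ → C (G ─ X)
    nonneg   : ∀ X → 0ℚ ≤ π X
    le-one   : ∀ X → π X ≤ 1ℚ
    total    : sumℚ (List.map π (allSubsets (n G))) ≡ 1ℚ
open FracPacking public

load : {C : GraphClass} {G : Graph} → FracPacking C G → Fin (n G) → ℚ
load {G = G} P v = sumℚ (List.map (π P) (filterᵇ (λ X → Vec.lookup X v) (allSubsets (n G))))

-- thickness = max over vertices of the load (0 for the empty graph).
thickness : {C : GraphClass} {G : Graph} → FracPacking C G → ℚ
thickness {G = G} P = foldr (λ v r → load P v ⊔ r) 0ℚ (allFin (n G))

FractionallyVsFragile : GraphClass → Set₁
FractionallyVsFragile 𝒢 =
  ∀ (ε : ℚ) → 0ℚ < ε →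
    Σ GraphClass λ C → InVs C ×
      (∀ G → 𝒢 G → Σ (FracPacking C G) λ P → thickness P ≤ ε)

degree : (G : Graph) → Fin (n G) → ℕ
degree G v = ∣ Vec.tabulate (adj G v) ∣

BoundedMaxDegree : GraphClass → Set
BoundedMaxDegree 𝒢 = Σ ℕ λ Δ → ∀ G → 𝒢 G → ∀ v → degree G v ≤ℕ Δ

-- Take a packing π of thickness at most 1/4 for a class whose graphs have components of
-- size at most t, and a vertex v of degree d. If π(X) > 0 and v ∉ X, every neighbour of v
-- lies in X or in the component of v in G - X, so d ≤ |N(v) ∩ X| + t. Weighting by π(X) and
-- summing over all X gives d ≤ Σ_{u ∈ N(v)} load(u) + t + d · load(v) ≤ d/4 + t + d/4,
-- hence d ≤ 2t.
module Submission where

open import Defs hiding (sym)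
open import Algebra.Bundles using (CommutativeMonoid)
open import Data.Empty using (⊥-elim)
open import Data.Bool using (Bool; true; false; not; T; if_then_else_)
open import Data.Fin as Fin using (Fin)
open import Data.Fin.Subset using (Subset; ∣_∣) renaming (_∈_ to _∈ₛ_)
open import Data.List as List using (List; []; _∷_; filterᵇ; allFin; foldr; length)
import Data.List.Properties as List
open import Data.List.Membership.Propositional.Properties using (∈-allFin; ∈-filter⁺)
open import Data.List.Relation.Unary.Any as Any using (Any; here; there)
open import Data.List.Relation.Unary.Any.Properties using (lookup-index)
open import Data.Nat as ℕ using (ℕ; zero; suc; z≤n; s≤s)
  renaming (_≤_ to _≤ℕ_; _<_ to _<ℕ_; _+_ to _+ℕ_)
import Data.Nat.Properties as ℕ
open import Data.Product using (_,_)
import Data.Integer as ℤ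
open import Data.Rational using (ℚ; 0ℚ; 1ℚ; ½; _/_; _+_; _⊔_; _≤_; _<_; -_)
open import Data.Rational.Properties
open import Data.Unit using (tt)
import Data.Vec as Vec
import Data.Vec.Properties as Vec
open import Function using (_∘_)
open import Relation.Nullary using (yes; no)
open import Relation.Nullary.Decidable using (T?)
open import Relation.Binary.PropositionalEquality

open import Algebra.Properties.CommutativeMonoid.Mult +-0-commutativeMonoid
  using (_×_; ×-homo-+; ×-distrib-+)
open import Algebra.Properties.CommutativeSemigroup
  (CommutativeMonoid.commutativeSemigroup +-0-commutativeMonoid) using (interchange; xy∙z≈xz∙y)

p≤p+q : ∀ p {q} → 0ℚ ≤ q → p ≤ p + q
p≤p+q p {q} 0≤q = subst (_≤ p + q) (+-identityʳ p) (+-monoʳ-≤ p 0≤q)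

p≤q+p : ∀ p {q} → 0ℚ ≤ q → p ≤ q + p
p≤q+p p {q} 0≤q = subst (p ≤_) (+-comm p q) (p≤p+q p 0≤q)

+-nonNeg : ∀ {p q} → 0ℚ ≤ p → 0ℚ ≤ q → 0ℚ ≤ p + q
+-nonNeg 0≤p 0≤q = ≤-trans 0≤p (p≤p+q _ 0≤q)

+-cancelˡ-≤ : ∀ r {p q} → r + p ≤ r + q → p ≤ q
+-cancelˡ-≤ r {p} {q} r+p≤r+q = subst₂ _≤_ (-r+[r+x]≡x p) (-r+[r+x]≡x q) (+-monoʳ-≤ (- r) r+p≤r+q)
  where
  -r+[r+x]≡x : ∀ x → - r + (r + x) ≡ x
  -r+[r+x]≡x x = trans (sym (+-assoc (- r) r x)) (trans (cong (_+ x) (+-inverseˡ r)) (+-identityˡ x))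

×-zeroʳ : ∀ n → n × 0ℚ ≡ 0ℚ
×-zeroʳ zero    = refl
×-zeroʳ (suc n) = trans (+-identityˡ (n × 0ℚ)) (×-zeroʳ n)

×-nonNeg : ∀ n {q} → 0ℚ ≤ q → 0ℚ ≤ n × q
×-nonNeg zero    _   = ≤-refl
×-nonNeg (suc n) 0≤q = +-nonNeg 0≤q (×-nonNeg n 0≤q)

×-monoʳ-≤ : ∀ n {q r} → q ≤ r → n × q ≤ n × r
×-monoʳ-≤ zero    _   = ≤-refl
×-monoʳ-≤ (suc n) q≤r = +-mono-≤ q≤r (×-monoʳ-≤ n q≤r)

×-monoˡ-≤ : ∀ {q} → 0ℚ ≤ q → ∀ {m n} → m ≤ℕ n → m × q ≤ n × q
×-monoˡ-≤     0≤q {n = n} z≤n       = ×-nonNeg n 0≤q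
×-monoˡ-≤ {q} 0≤q         (s≤s m≤n) = +-monoʳ-≤ q (×-monoˡ-≤ 0≤q m≤n)

×-monoˡ-< : ∀ {q} → 0ℚ < q → ∀ {m n} → m <ℕ n → m × q < n × q
×-monoˡ-<     0<q {zero}  {suc n} _         = +-mono-<-≤ 0<q (×-nonNeg n (<⇒≤ 0<q))
×-monoˡ-< {q} 0<q {suc m} {suc n} (s≤s m<n) = +-monoʳ-< q (×-monoˡ-< 0<q m<n)

×-cancelʳ-≤ : ∀ {q} → 0ℚ < q → ∀ {m n} → m × q ≤ n × q → m ≤ℕ n
×-cancelʳ-≤ 0<q {m} {n} mq≤nq with m ℕ.≤? n
... | yes m≤n = m≤n
... | no  m≰n = ⊥-elim (<-irrefl refl (<-≤-trans (×-monoˡ-< 0<q (ℕ.≰⇒> m≰n)) mq≤nq))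

∑ : {A : Set} → List A → (A → ℚ) → ℚ
∑ xs f = sumℚ (List.map f xs)

syntax ∑ xs (λ x → e) = ∑[ x ∈ xs ] e

module _ {A : Set} where

  ∑-cong : ∀ xs {f g : A → ℚ} → (∀ x → f x ≡ g x) → ∑ xs f ≡ ∑ xs g
  ∑-cong []       _   = refl
  ∑-cong (x ∷ xs) f≗g = cong₂ _+_ (f≗g x) (∑-cong xs f≗g)

  ∑-mono-≤ : ∀ xs {f g : A → ℚ} → (∀ x → f x ≤ g x) → ∑ xs f ≤ ∑ xs g
  ∑-mono-≤ []       _   = ≤-refl
  ∑-mono-≤ (x ∷ xs) f≤g = +-mono-≤ (f≤g x) (∑-mono-≤ xs f≤g)

  ∑-nonNeg : ∀ xs {f : A → ℚ} → (∀ x → 0ℚ ≤ f x) → 0ℚ ≤ ∑ xs f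
  ∑-nonNeg []       _    = ≤-refl
  ∑-nonNeg (x ∷ xs) 0≤f = +-nonNeg (0≤f x) (∑-nonNeg xs 0≤f)

  ∑-distrib-+ : ∀ xs (f g : A → ℚ) → ∑[ x ∈ xs ] (f x + g x) ≡ ∑ xs f + ∑ xs g
  ∑-distrib-+ []       _ _ = sym (+-identityˡ 0ℚ)
  ∑-distrib-+ (x ∷ xs) f g =
    trans (cong (f x + g x +_) (∑-distrib-+ xs f g)) (interchange (f x) (g x) _ _)

  ∑-const : ∀ (xs : List A) q → ∑[ x ∈ xs ] q ≡ length xs × q
  ∑-const []       _ = refl
  ∑-const (x ∷ xs) q = cong (q +_) (∑-const xs q)

  ∑-× : ∀ n xs (f : A → ℚ) → ∑[ x ∈ xs ] (n × f x) ≡ n × ∑ xs f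
  ∑-× n []       _ = sym (×-zeroʳ n)
  ∑-× n (x ∷ xs) f = trans (cong (n × f x +_) (∑-× n xs f)) (sym (×-distrib-+ (f x) _ n))

  ∑-filterᵇ : ∀ (p : A → Bool) xs f → ∑ (filterᵇ p xs) f ≡ ∑[ x ∈ xs ] (if p x then f x else 0ℚ)
  ∑-filterᵇ p []       f = refl
  ∑-filterᵇ p (x ∷ xs) f with p x
  ... | true  = cong (f x +_) (∑-filterᵇ p xs f)
  ... | false = trans (∑-filterᵇ p xs f) (sym (+-identityˡ _))

∑-comm : ∀ {A B : Set} xs ys (g : A → B → ℚ) →
         ∑[ x ∈ xs ] ∑[ y ∈ ys ] g x y ≡ ∑[ y ∈ ys ] ∑[ x ∈ xs ] g x y
∑-comm []       ys g = sym (trans (∑-const ys 0ℚ) (×-zeroʳ (length ys)))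
∑-comm (x ∷ xs) ys g =
  trans (cong (∑ ys (g x) +_) (∑-comm xs ys g)) (sym (∑-distrib-+ ys (g x) _))

length×-split : ∀ {A : Set} (b : A → Bool) xs q →
  length xs × q ≡ ∑[ x ∈ xs ] (if b x then q else 0ℚ) + length (filterᵇ (not ∘ b) xs) × q
length×-split b xs q = begin
  length xs × q                                                        ≡⟨ ∑-const xs q ⟨
  ∑[ x ∈ xs ] q                                                        ≡⟨ ∑-cong xs (if-split ∘ b) ⟩
  ∑[ x ∈ xs ] ((if b x then q else 0ℚ) + (if not (b x) then q else 0ℚ)) ≡⟨ ∑-distrib-+ xs _ _ ⟩
  ∑[ x ∈ xs ] (if b x then q else 0ℚ) + ∑[ x ∈ xs ] (if not (b x) then q else 0ℚ)
    ≡⟨ cong (∑[ x ∈ xs ] (if b x then q else 0ℚ) +_) outside-count ⟩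
  ∑[ x ∈ xs ] (if b x then q else 0ℚ) + length (filterᵇ (not ∘ b) xs) × q ∎
  where
  open ≡-Reasoning
  outside-count : ∑[ x ∈ xs ] (if not (b x) then q else 0ℚ) ≡ length (filterᵇ (not ∘ b) xs) × q
  outside-count = trans (sym (∑-filterᵇ (not ∘ b) xs (λ _ → q))) (∑-const (filterᵇ (not ∘ b) xs) q)
  if-split : ∀ c → q ≡ (if c then q else 0ℚ) + (if not c then q else 0ℚ)
  if-split true  = sym (+-identityʳ q)
  if-split false = sym (+-identityˡ q)

filterᵇ-comm : ∀ {A : Set} (p q : A → Bool) xs → filterᵇ p (filterᵇ q xs) ≡ filterᵇ q (filterᵇ p xs)
filterᵇ-comm p q []       = refl
filterᵇ-comm p q (x ∷ xs) with p x in px | q x in qx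
... | true  | true  rewrite px | qx = cong (x ∷_) (filterᵇ-comm p q xs)
... | true  | false rewrite qx      = filterᵇ-comm p q xs
... | false | true  rewrite px      = filterᵇ-comm p q xs
... | false | false                 = filterᵇ-comm p q xs

∣tabulate∣≡length-filterᵇ : ∀ {A : Set} n (g : Fin n → A) (p : A → Bool) →
  ∣ Vec.tabulate (p ∘ g) ∣ ≡ length (filterᵇ p (List.tabulate g))
∣tabulate∣≡length-filterᵇ zero    g p = refl
∣tabulate∣≡length-filterᵇ (suc n) g p with p (g Fin.zero)
... | true  = cong suc (∣tabulate∣≡length-filterᵇ n (g ∘ Fin.suc) p)
... | false = ∣tabulate∣≡length-filterᵇ n (g ∘ Fin.suc) p

≤-foldr-⊔ : ∀ {A : Set} (f : A → ℚ) {x xs} → Any (x ≡_) xs → f x ≤ foldr (λ y r → f y ⊔ r) 0ℚ xs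
≤-foldr-⊔ f (here refl) = p≤p⊔q (f _) _
≤-foldr-⊔ f (there x∈xs) = p≤q⇒p≤r⊔q (f _) (≤-foldr-⊔ f x∈xs)

neighbours : (G : Graph) → Fin (n G) → List (Fin (n G))
neighbours G v = filterᵇ (adj G v) (allFin (n G))

outside : ∀ {m} → Subset m → Fin m → Bool
outside X u = not (Vec.lookup X u)

degree≡length-neighbours : ∀ G v → degree G v ≡ length (neighbours G v)
degree≡length-neighbours G v = ∣tabulate∣≡length-filterᵇ (n G) (λ u → u) (adj G v)

neighboursOutside-≤ : ∀ G X t → ComponentsAtMost t (G ─ X) → ∀ v → Vec.lookup X v ≡ false →
                      length (filterᵇ (outside X) (neighbours G v)) ≤ℕ t
neighboursOutside-≤ G X t small v v∉X = subst (_≤ℕ t) ∣S∣≡ (small (Any.index v∈rest) S reach)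
  where
  open ≡-Reasoning
  rest = remaining G X
  v∈rest : Any (v ≡_) rest
  v∈rest = ∈-filter⁺ (T? ∘ outside X) (∈-allFin v) (subst (T ∘ not) (sym v∉X) tt)
  S : Subset (length rest)
  S = Vec.tabulate (adj G v ∘ List.lookup rest)
  reach : ∀ u → u ∈ₛ S → Reach (G ─ X) (Any.index v∈rest) u
  reach u u∈S = step (subst (λ w → T (adj G w (List.lookup rest u))) (lookup-index v∈rest) vu) here
    where
    vu : T (adj G v (List.lookup rest u))
    vu = subst T (sym (trans (sym (Vec.lookup∘tabulate _ u)) (Vec.[]=⇒lookup u∈S))) tt
  ∣S∣≡ : ∣ S ∣ ≡ length (filterᵇ (outside X) (neighbours G v))
  ∣S∣≡ = begin
    ∣ S ∣
      ≡⟨ ∣tabulate∣≡length-filterᵇ _ (List.lookup rest) (adj G v) ⟩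
    length (filterᵇ (adj G v) (List.tabulate (List.lookup rest)))
      ≡⟨ cong (length ∘ filterᵇ (adj G v)) (List.tabulate-lookup rest) ⟩
    length (filterᵇ (adj G v) rest)
      ≡⟨ cong length (filterᵇ-comm (adj G v) (outside X) (allFin (n G))) ⟩
    length (filterᵇ (outside X) (neighbours G v)) ∎

mass : ∀ {C G} → FracPacking C G → Subset (n G) → Fin (n G) → ℚ
mass P X u = if Vec.lookup X u then π P X else 0ℚ

mass-nonNeg : ∀ {C G} (P : FracPacking C G) X u → 0ℚ ≤ mass P X u
mass-nonNeg P X u with Vec.lookup X u
... | true  = nonneg P X
... | false = ≤-refl

module _ {C : GraphClass} {G : Graph} (P : FracPacking C G) where

  load≡∑mass : ∀ u → load P u ≡ ∑[ X ∈ allSubsets (n G) ] mass P X u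
  load≡∑mass u = ∑-filterᵇ (λ X → Vec.lookup X u) (allSubsets (n G)) (π P)

  load≤thickness : ∀ u → load P u ≤ thickness P
  load≤thickness u = ≤-foldr-⊔ (load P) (∈-allFin u)

module _ {C : GraphClass} {t : ℕ} (small : ∀ H → C H → ComponentsAtMost t H)
         {G : Graph} (P : FracPacking C G) (v : Fin (n G)) where

  outsideMass-≤ : ∀ X → Vec.lookup X v ≡ false →
                  length (filterᵇ (outside X) (neighbours G v)) × π P X ≤ t × π P X
  outsideMass-≤ X v∉X with π P X ≟ 0ℚ
  ... | yes πX≡0 rewrite πX≡0 | ×-zeroʳ (length (filterᵇ (outside X) (neighbours G v))) | ×-zeroʳ t
                 = ≤-refl
  ... | no  πX≢0 = ×-monoˡ-≤ (nonneg P X)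
                     (neighboursOutside-≤ G X t (small (G ─ X) (support P X πX≢0)) v v∉X)

  mass-≤ : ∀ X → let d = length (neighbours G v) in
           d × π P X ≤ ∑[ u ∈ neighbours G v ] mass P X u + t × π P X + d × mass P X v
  mass-≤ X with Vec.lookup X v in v∈?X
  ... | true  =
    p≤q+p _ (+-nonNeg (∑-nonNeg (neighbours G v) (mass-nonNeg P X)) (×-nonNeg t (nonneg P X)))
  ... | false = begin
    d × π P X
      ≡⟨ length×-split (Vec.lookup X) (neighbours G v) (π P X) ⟩
    A + length (filterᵇ (outside X) (neighbours G v)) × π P X
      ≤⟨ +-monoʳ-≤ A (outsideMass-≤ X v∈?X) ⟩
    A + t × π P X
      ≤⟨ p≤p+q _ (×-nonNeg d ≤-refl) ⟩
    A + t × π P X + d × 0ℚ ∎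
    where
    open ≤-Reasoning
    d = length (neighbours G v)
    A = ∑[ u ∈ neighbours G v ] mass P X u

  degree-inequality : ∀ {ε} → thickness P ≤ ε →
                      degree G v × 1ℚ ≤ degree G v × ε + t × 1ℚ + degree G v × ε
  degree-inequality {ε} thin rewrite degree≡length-neighbours G v = begin
    d × 1ℚ                                              ≡⟨ cong (d ×_) (total P) ⟨
    d × ∑ subsets (π P)                                 ≡⟨ ∑-× d subsets (π P) ⟨
    ∑[ X ∈ subsets ] (d × π P X)                        ≤⟨ ∑-mono-≤ subsets mass-≤ ⟩
    ∑[ X ∈ subsets ] (A X + t × π P X + d × mass P X v) ≡⟨ ∑-rearrange ⟩
    ∑ subsets A + t × 1ℚ + d × load P v                 ≤⟨ +-mono-≤ (+-monoˡ-≤ _ ∑A≤) (×-monoʳ-≤ d (load≤ε v)) ⟩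
    d × ε + t × 1ℚ + d × ε                              ∎
    where
    open ≤-Reasoning
    N = neighbours G v
    d = length N
    subsets = allSubsets (n G)
    A : Subset (n G) → ℚ
    A X = ∑[ u ∈ N ] mass P X u
    load≤ε : ∀ u → load P u ≤ ε
    load≤ε u = ≤-trans (load≤thickness P u) thin
    ∑A≤ : ∑ subsets A ≤ d × ε
    ∑A≤ = begin
      ∑[ X ∈ subsets ] ∑[ u ∈ N ] mass P X u ≡⟨ ∑-comm subsets N (mass P) ⟩
      ∑[ u ∈ N ] ∑[ X ∈ subsets ] mass P X u ≡⟨ ∑-cong N (load≡∑mass P) ⟨
      ∑[ u ∈ N ] load P u                    ≤⟨ ∑-mono-≤ N load≤ε ⟩
      ∑[ u ∈ N ] ε                           ≡⟨ ∑-const N ε ⟩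
      d × ε                                  ∎
    ∑-rearrange : ∑[ X ∈ subsets ] (A X + t × π P X + d × mass P X v) ≡
                  ∑ subsets A + t × 1ℚ + d × load P v
    ∑-rearrange = begin-equality
      ∑[ X ∈ subsets ] (A X + t × π P X + d × mass P X v)
        ≡⟨ ∑-distrib-+ subsets _ _ ⟩
      ∑[ X ∈ subsets ] (A X + t × π P X) + ∑[ X ∈ subsets ] (d × mass P X v)
        ≡⟨ cong₂ _+_ (∑-distrib-+ subsets A _) (∑-× d subsets (λ X → mass P X v)) ⟩
      ∑ subsets A + ∑[ X ∈ subsets ] (t × π P X) + d × ∑[ X ∈ subsets ] mass P X v
        ≡⟨ cong₂ (λ a b → ∑ subsets A + a + d × b)
                 (trans (∑-× t subsets (π P)) (cong (t ×_) (total P))) (sym (load≡∑mass P v)) ⟩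
      ∑ subsets A + t × 1ℚ + d × load P v ∎

¼ : ℚ
¼ = ℤ.+ 1 / 4

n≤n/4+m+n/4⇒n≤2m : ∀ n m → n × 1ℚ ≤ n × ¼ + m × 1ℚ + n × ¼ → n ≤ℕ m +ℕ m
n≤n/4+m+n/4⇒n≤2m n m n≤n/4+m+n/4 = ×-cancelʳ-≤ (positive⁻¹ ½) (begin
  n × ½               ≤⟨ +-cancelˡ-≤ (n × ½) n/2+n/2≤n/2+m ⟩
  m × 1ℚ              ≡⟨ ×-distrib-+ ½ ½ m ⟩
  m × ½ + m × ½       ≡⟨ ×-homo-+ ½ m m ⟨
  (m +ℕ m) × ½        ∎)
  where
  open ≤-Reasoning
  n/2+n/2≤n/2+m : n × ½ + n × ½ ≤ n × ½ + m × 1ℚ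
  n/2+n/2≤n/2+m = begin
    n × ½ + n × ½           ≡⟨ ×-distrib-+ ½ ½ n ⟨
    n × 1ℚ                  ≤⟨ n≤n/4+m+n/4 ⟩
    n × ¼ + m × 1ℚ + n × ¼  ≡⟨ xy∙z≈xz∙y (n × ¼) (m × 1ℚ) (n × ¼) ⟩
    n × ¼ + n × ¼ + m × 1ℚ  ≡⟨ cong (_+ m × 1ℚ) (×-distrib-+ ¼ ¼ n) ⟨
    n × ½ + m × 1ℚ          ∎

mainTheorem9 : (𝒢 : GraphClass) → FractionallyVsFragile 𝒢 → BoundedMaxDegree 𝒢
mainTheorem9 𝒢 fragile with fragile ¼ (positive⁻¹ ¼)
... | C , (t , small) , packing = t +ℕ t , maxDegree≤2t
  where
  maxDegree≤2t : ∀ G → 𝒢 G → ∀ v → degree G v ≤ℕ t +ℕ t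
  maxDegree≤2t G G∈𝒢 v with packing G G∈𝒢
  ... | P , thin = n≤n/4+m+n/4⇒n≤2m (degree G v) t (degree-inequality small P v thin)
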